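{- Let $k\geq 2$ be an integer, $\lambda$ a positive integer, and $a_{k,n}^{k}$ the $k$-th sequence of generalized order-$k$ numbers defined in the context. Let $\iota=\sqrt{ -1}$. For $n\ge1$ let $H_{k,n}=(h_{st})$ be the $n\times n$ matrix with \[ h_{st}=\begin{cases}\iota^{s-t}&\text{if } -1\le s-t<k\text{ and } s\ne t,\\ \lambda&\text{if } s=t,\\ 0&\text{otherwise}\end{cases} \] (so the superdiagonal entries are $\iota^{ -1}=-\iota$). Then $\operatorname{per}(H_{k,n})=a_{k,n+1}^{k}$ for all $n\ge1$, where $\operatorname{per}(A)=\sum_{\sigma\in S_n}\prod_{r=1}^n a_{r,\sigma(r)}$ is the permanent.
   Context: For a positive integer $k$ and a positive integer $\lambda$, the $k$ sequences of generalized order-$k$ numbers are defined as follows: for each $1\le i\le k$, the sequence $(a_{k,n}^{i})_{n\ge 1-k}$ has initial values $a_{k,n}^{i}=1$ if $i=1-n$ and $a_{k,n}^{i}=0$ otherwise, for $1-k\le n\le 0$, and satisfies $a_{k,n}^{i}=\lambda a_{k,n-1}^{i}+a_{k,n-2}^{i}+\cdots+a_{k,n-k}^{i}$ for $n\ge 1$. The $k$-th sequence is the one with $i=k$. -}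

module Defs where

open import Data.Nat as ℕ using (ℕ; zero; suc; _∸_)
open import Data.Integer as ℤ using (ℤ; +_; -[1+_]; _⊖_)
open import Data.Integer.DivMod using (_%ℕ_)
open import Data.Fin as Fin using (Fin; toℕ)
open import Data.Fin.Properties using (all?)
open import Data.List as List using (List; []; _∷_; map; concatMap; filter; foldr; take; drop)
open import Data.Nat.ListAction using (sum)
open import Data.Bool using (if_then_else_)
open import Relation.Nullary using (Dec; does)
open import Relation.Nullary.Decidable using (_→-dec_)
open import Relation.Nullary.Decidable using (_×-dec_)
open import Relation.Binary.PropositionalEquality using (_≡_)

-- Gaussian integers ℤ[ι] = { a + b ι | a b ∈ ℤ } ⊆ ℂ
-- (all matrix entries and the permanent live here)

record ℤ[ι] : Set where
  constructor _+_ι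
  field
    re : ℤ
    im : ℤ
open ℤ[ι] public

infixl 6 _⊕_
infixl 7 _⊗_

_⊕_ : ℤ[ι] → ℤ[ι] → ℤ[ι]
(a + b ι) ⊕ (c + d ι) = (a ℤ.+ c) + (b ℤ.+ d) ι

_⊗_ : ℤ[ι] → ℤ[ι] → ℤ[ι]
(a + b ι) ⊗ (c + d ι) = (a ℤ.* c ℤ.- b ℤ.* d) + (a ℤ.* d ℤ.+ b ℤ.* c) ι

𝟘 𝟙 : ℤ[ι]
𝟘 = (+ 0) + (+ 0) ι
𝟙 = (+ 1) + (+ 0) ι

fromℕ : ℕ → ℤ[ι]
fromℕ m = (+ m) + (+ 0) ι

ιpow : ℤ → ℤ[ι]
ιpow d with d %ℕ 4
... | 0 = (+ 1) + (+ 0) ι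
... | 1 = (+ 0) + (+ 1) ι
... | 2 = -[1+ 0 ] + (+ 0) ι
... | _ = (+ 0) + -[1+ 0 ] ι

-- Permanent: per(A) = Σ_{σ ∈ S_n} Π_r A r (σ r).
-- S_n is realised as the bijections Fin n → Fin n, i.e. the injective
-- endofunctions of the finite set Fin n, enumerated explicitly.

Matrix : ℕ → Set
Matrix n = Fin n → Fin n → ℤ[ι]

allFuns : (n m : ℕ) → List (Fin n → Fin m)
allFuns zero    m = (λ ()) ∷ []
allFuns (suc n) m =
  concatMap (λ j → map (λ f → λ { Fin.zero → j ; (Fin.suc x) → f x }) (allFuns n m))
            (List.allFin m)

IsPerm : {n : ℕ} → (Fin n → Fin n) → Set
IsPerm {n} σ = ∀ (i j : Fin n) → σ i ≡ σ j → i ≡ j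

isPerm? : {n : ℕ} (σ : Fin n → Fin n) → Dec (IsPerm σ)
isPerm? σ = all? λ i → all? λ j → (σ i Fin.≟ σ j) →-dec (i Fin.≟ j)

Sym : (n : ℕ) → List (Fin n → Fin n)
Sym n = filter isPerm? (allFuns n n)

prodFin : (n : ℕ) → (Fin n → ℤ[ι]) → ℤ[ι]
prodFin zero    f = 𝟙
prodFin (suc n) f = f Fin.zero ⊗ prodFin n (λ x → f (Fin.suc x))

sumList : List ℤ[ι] → ℤ[ι]
sumList = foldr _⊕_ 𝟘

per : {n : ℕ} → Matrix n → ℤ[ι]
per {n} A = sumList (map (λ σ → prodFin n (λ r → A r (σ r))) (Sym n))

-- The matrix H_{k,n} (0-based indices s t; only s - t matters):
--   h_st = ι^(s-t) if -1 ≤ s-t < k and s ≠ t,  λ if s = t,  0 otherwise.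

H : (k λ' n : ℕ) → Matrix n
H k λ' n s t =
  if does (toℕ s ℕ.≟ toℕ t) then fromℕ λ'
  else if does ((-[1+ 0 ] ℤ.≤? d) ×-dec (d ℤ.<? + k)) then ιpow d
  else 𝟘
  where d = toℕ s ⊖ toℕ t

-- Generalized order-k numbers a^i_{k,n}, n ≥ 1-k.
-- We index by m = n + k - 1 ∈ ℕ, i.e.  ordK k λ i m = a^i_{k, m+1-k}.
-- Initial values (0 ≤ m < k, i.e. 1-k ≤ n ≤ 0): 1 iff i = 1-n, i.e. i + m = k.
-- Recurrence (m ≥ k, i.e. n ≥ 1):
--   a_n = λ a_{n-1} + a_{n-2} + ... + a_{n-k}.

initVal : (k i m : ℕ) → ℕ
initVal k i m = if does ((i ℕ.+ m) ℕ.≟ k) then 1 else 0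

-- history k λ i m = [ b m , b (m-1) , ... , b 0 ]   where b = ordK k λ i
history : (k λ' i m : ℕ) → List ℕ
history k λ' i zero    = initVal k i 0 ∷ []
history k λ' i (suc m) = next ∷ prev
  where
    prev = history k λ' i m
    headOr0 : List ℕ → ℕ
    headOr0 []      = 0
    headOr0 (x ∷ _) = x
    next = if does (suc m ℕ.<? k) then initVal k i (suc m)
           else λ' ℕ.* headOr0 prev ℕ.+ sum (take (k ∸ 1) (drop 1 prev))

ordK : (k λ' i m : ℕ) → ℕ
ordK k λ' i m with history k λ' i m
... | []      = 0
... | (x ∷ _) = x

a : (k λ' i n : ℕ) → ℕ
a k λ' i n = ordK k λ' i (n ℕ.+ k ∸ 1)

{-# OPTIONS --safe #-}
module Submission where

-- Expanding a permanent along its first row leaves, for a lower Hessenberg Toeplitz matrix, only two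
-- minors: deleting the first column gives the same matrix one size smaller, and deleting the second
-- column gives the matrix whose first column is read one row further down. So the permanents P d m of
-- the (m+1)×(m+1) matrices with first column shifted down by d satisfy
--   P d (m+1) = h_{d,0} · P 0 m + h_{0,1} · P (d+1) m.
-- For H_{k,n}, h_{d,0} = ι^d c_d with c_0 = λ, c_d = 1 for 0 < d < k, c_d = 0 for d ≥ k, and
-- h_{0,1} = -ι. Since -ι · ι^(d+1) = ι^d, P d m = ι^d T d m where T d (m+1) = c_d T 0 m + T (d+1) m,
-- and the defining recurrence of the order-k numbers shows that T 0 m = a_{m+2} solves this,
-- together with T (d+1) m = a_{m+1} + ⋯ + a_{m+d+3-k}.

open import Defs
open import Data.Nat as ℕ using (ℕ; zero; suc; _∸_; _≤_; _<_; s≤s)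
open import Data.Nat.ListAction using () renaming (sum to sumℕ)
import Data.Nat.Properties as ℕ
open import Relation.Binary.PropositionalEquality
  using (_≡_; refl; sym; trans; cong; cong₂; subst; isEquivalence; _≢_; _≗_; module ≡-Reasoning)
open import Algebra.Bundles using (CommutativeSemiring)
open import Algebra.Structures using (IsCommutativeSemiring)
open import Algebra.Structures.Biased using (isCommutativeMonoidˡ; isCommutativeSemiringˡ)
open import Data.Integer using (ℤ; +_; -[1+_]; _⊖_)
import Data.Integer.Properties as ℤ
open import Data.Integer.Tactic.RingSolver using (solve-∀)
open import Data.Bool using (Bool; true; false; not; _∧_; if_then_else_)
open import Data.Product using (_×_; _,_)
open import Data.Empty using (⊥-elim)
open import Data.Fin as Fin using (Fin; zero; suc; punchIn; toℕ)
open import Data.Fin.Patterns using (0F; 1F)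
open import Data.Fin.Properties using (all?; 0≢1+n; punchIn-injective; punchInᵢ≢i; suc-injective)
open import Data.List as List using (List; []; _∷_; map; concatMap; filter; _++_; take; drop; _∷ʳ_)
import Data.List.Properties as List
import Data.Vec.Functional as Vector
open import Function using (_∘_; id; _⇔_; mk⇔)
open import Level using (0ℓ)
open import Relation.Nullary using (Dec; yes; no; does; ¬_; ¬?; _×-dec_; _→-dec_)
open import Relation.Nullary.Decidable using (dec-true; dec-false; does-⇔)

-- Gaussian integers

ℤ[ι]-≡ : ∀ {a b c d} → a ≡ c → b ≡ d → a + b ι ≡ c + d ι
ℤ[ι]-≡ refl refl = refl

⊕-assoc : ∀ x y z → (x ⊕ y) ⊕ z ≡ x ⊕ (y ⊕ z)
⊕-assoc (a + b ι) (c + d ι) (e + f ι) = ℤ[ι]-≡ (ℤ.+-assoc a c e) (ℤ.+-assoc b d f)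

⊕-identityˡ : ∀ x → 𝟘 ⊕ x ≡ x
⊕-identityˡ (a + b ι) = ℤ[ι]-≡ (ℤ.+-identityˡ a) (ℤ.+-identityˡ b)

⊕-comm : ∀ x y → x ⊕ y ≡ y ⊕ x
⊕-comm (a + b ι) (c + d ι) = ℤ[ι]-≡ (ℤ.+-comm a c) (ℤ.+-comm b d)

-- The ring solver sees x ⊗ y only through the projections re and im, so each law is reduced to
-- identities between explicit real and imaginary parts.
module _ where
  open import Data.Integer using (_+_; _*_; _-_)

  ⊗-assoc : ∀ x y z → (x ⊗ y) ⊗ z ≡ x ⊗ (y ⊗ z)
  ⊗-assoc (a + b ι) (c + d ι) (e + f ι) = ℤ[ι]-≡ (real a b c d e f) (imaginary a b c d e f)
    where
    real : ∀ a b c d e f →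
      (a * c - b * d) * e - (a * d + b * c) * f ≡ a * (c * e - d * f) - b * (c * f + d * e)
    real = solve-∀
    imaginary : ∀ a b c d e f →
      (a * c - b * d) * f + (a * d + b * c) * e ≡ a * (c * f + d * e) + b * (c * e - d * f)
    imaginary = solve-∀

  ⊗-identityˡ : ∀ x → 𝟙 ⊗ x ≡ x
  ⊗-identityˡ (a + b ι) = ℤ[ι]-≡ (real a b) (imaginary a b)
    where
    real : ∀ a b → + 1 * a - + 0 * b ≡ a
    real = solve-∀
    imaginary : ∀ a b → + 1 * b + + 0 * a ≡ b
    imaginary = solve-∀

  ⊗-comm : ∀ x y → x ⊗ y ≡ y ⊗ x
  ⊗-comm (a + b ι) (c + d ι) = ℤ[ι]-≡ (real a b c d) (imaginary a b c d)
    where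
    real : ∀ a b c d → a * c - b * d ≡ c * a - d * b
    real = solve-∀
    imaginary : ∀ a b c d → a * d + b * c ≡ c * b + d * a
    imaginary = solve-∀

  ⊗-distribʳ-⊕ : ∀ x y z → (y ⊕ z) ⊗ x ≡ y ⊗ x ⊕ z ⊗ x
  ⊗-distribʳ-⊕ (a + b ι) (c + d ι) (e + f ι) = ℤ[ι]-≡ (real a b c d e f) (imaginary a b c d e f)
    where
    real : ∀ a b c d e f → (c + e) * a - (d + f) * b ≡ (c * a - d * b) + (e * a - f * b)
    real = solve-∀
    imaginary : ∀ a b c d e f → (c + e) * b + (d + f) * a ≡ (c * b + d * a) + (e * b + f * a)
    imaginary = solve-∀

  ⊗-zeroˡ : ∀ x → 𝟘 ⊗ x ≡ 𝟘
  ⊗-zeroˡ (a + b ι) = ℤ[ι]-≡ (real a b) (imaginary a b)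
    where
    real : ∀ a b → + 0 * a - + 0 * b ≡ + 0
    real = solve-∀
    imaginary : ∀ a b → + 0 * b + + 0 * a ≡ + 0
    imaginary = solve-∀

  fromℕ-* : ∀ m n → fromℕ (m ℕ.* n) ≡ fromℕ m ⊗ fromℕ n
  fromℕ-* m n = ℤ[ι]-≡ (trans (ℤ.pos-* m n) (real (+ m) (+ n))) (imaginary (+ m) (+ n))
    where
    real : ∀ x y → x * y ≡ x * y - + 0 * + 0
    real = solve-∀
    imaginary : ∀ x y → + 0 ≡ x * + 0 + + 0 * y
    imaginary = solve-∀

ℤ[ι]-isCommutativeSemiring : IsCommutativeSemiring _≡_ _⊕_ _⊗_ 𝟘 𝟙
ℤ[ι]-isCommutativeSemiring = isCommutativeSemiringˡ record
  { +-isCommutativeMonoid = isCommutativeMonoidˡ record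
    { isSemigroup = record
      { isMagma = record { isEquivalence = isEquivalence ; ∙-cong = cong₂ _⊕_ }
      ; assoc   = ⊕-assoc
      }
    ; identityˡ = ⊕-identityˡ
    ; comm = ⊕-comm
    }
  ; *-isCommutativeMonoid = isCommutativeMonoidˡ record
    { isSemigroup = record
      { isMagma = record { isEquivalence = isEquivalence ; ∙-cong = cong₂ _⊗_ }
      ; assoc   = ⊗-assoc
      }
    ; identityˡ = ⊗-identityˡ
    ; comm = ⊗-comm
    }
  ; distribʳ = ⊗-distribʳ-⊕
  ; zeroˡ = ⊗-zeroˡ
  }

ℤ[ι]-commutativeSemiring : CommutativeSemiring 0ℓ 0ℓ
ℤ[ι]-commutativeSemiring = record { isCommutativeSemiring = ℤ[ι]-isCommutativeSemiring }

open CommutativeSemiring ℤ[ι]-commutativeSemiring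
  using ()
  renaming ( +-identityʳ to ⊕-identityʳ ; *-identityʳ to ⊗-identityʳ
           ; zeroʳ to ⊗-zeroʳ ; distribˡ to ⊗-distribˡ-⊕ )

-ι : ℤ[ι]
-ι = (+ 0) + -[1+ 0 ] ι

-ι⊗ιpow-suc : ∀ d → -ι ⊗ ιpow (+ suc d) ≡ ιpow (+ d)
-ι⊗ιpow-suc 0 = refl
-ι⊗ιpow-suc 1 = refl
-ι⊗ιpow-suc 2 = refl
-ι⊗ιpow-suc 3 = refl
-ι⊗ιpow-suc (suc (suc (suc (suc d)))) = -ι⊗ιpow-suc d

-- First-row expansion of the permanent

open CommutativeSemiring ℤ[ι]-commutativeSemiring using (semiring)
open import Algebra.Properties.Semiring.Sum semiring
  using (sum; sum-syntax; sum-cong-≗; sum-remove; sum-replicate-zero)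

infixr 8 [_]·_

[_]·_ : Bool → ℤ[ι] → ℤ[ι]
[ true  ]· x = x
[ false ]· x = 𝟘

[∧]· : ∀ a b x → [ a ∧ b ]· x ≡ [ a ]· [ b ]· x
[∧]· true  b x = refl
[∧]· false b x = refl

[]·-⊗ : ∀ b x y → [ b ]· (x ⊗ y) ≡ x ⊗ [ b ]· y
[]·-⊗ true  x y = refl
[]·-⊗ false x y = sym (⊗-zeroʳ x)

sumList-++ : ∀ xs ys → sumList (xs ++ ys) ≡ sumList xs ⊕ sumList ys
sumList-++ []       ys = sym (⊕-identityˡ _)
sumList-++ (x ∷ xs) ys = trans (cong (x ⊕_) (sumList-++ xs ys)) (sym (⊕-assoc x _ _))

sumList-concatMap : ∀ {A B : Set} (F : B → ℤ[ι]) (h : A → List B) xs →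
  sumList (map F (concatMap h xs)) ≡ sumList (map (λ x → sumList (map F (h x))) xs)
sumList-concatMap F h []       = refl
sumList-concatMap F h (x ∷ xs) = begin
  sumList (map F (h x ++ concatMap h xs))
    ≡⟨ cong sumList (List.map-++ F (h x) _) ⟩
  sumList (map F (h x) ++ map F (concatMap h xs))
    ≡⟨ sumList-++ (map F (h x)) _ ⟩
  sumList (map F (h x)) ⊕ sumList (map F (concatMap h xs))
    ≡⟨ cong (sumList (map F (h x)) ⊕_) (sumList-concatMap F h xs) ⟩
  sumList (map (λ x → sumList (map F (h x))) (x ∷ xs)) ∎
  where open ≡-Reasoning

sumList-allFin : ∀ n (F : Fin n → ℤ[ι]) → sumList (map F (List.allFin n)) ≡ sum F
sumList-allFin n F = trans (cong sumList (List.map-tabulate id F)) (sumList-tabulate n F)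
  where
  sumList-tabulate : ∀ n (F : Fin n → ℤ[ι]) → sumList (List.tabulate F) ≡ sum F
  sumList-tabulate zero    F = refl
  sumList-tabulate (suc n) F = cong (F zero ⊕_) (sumList-tabulate n (F ∘ suc))

sumList-[]· : ∀ {A : Set} b (F : A → ℤ[ι]) xs →
  sumList (map (λ x → [ b ]· F x) xs) ≡ [ b ]· sumList (map F xs)
sumList-[]· true  F xs       = refl
sumList-[]· false F []       = refl
sumList-[]· false F (x ∷ xs) = trans (cong (𝟘 ⊕_) (sumList-[]· false F xs)) (⊕-identityˡ 𝟘)

sumList-⊗ : ∀ {A : Set} c (F : A → ℤ[ι]) xs →
  sumList (map (λ x → c ⊗ F x) xs) ≡ c ⊗ sumList (map F xs)
sumList-⊗ c F []       = sym (⊗-zeroʳ c)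
sumList-⊗ c F (x ∷ xs) = trans (cong (c ⊗ F x ⊕_) (sumList-⊗ c F xs)) (sym (⊗-distribˡ-⊕ c _ _))

sumList-filter : ∀ {A : Set} {P : A → Set} (P? : ∀ x → Dec (P x)) (F : A → ℤ[ι]) xs →
  sumList (map F (filter P? xs)) ≡ sumList (map (λ x → [ does (P? x) ]· F x) xs)
sumList-filter P? F []       = refl
sumList-filter P? F (x ∷ xs) with does (P? x)
... | true  = cong (F x ⊕_) (sumList-filter P? F xs)
... | false = trans (sumList-filter P? F xs) (sym (⊕-identityˡ _))

IsInjective : ∀ {n m} → (Fin n → Fin m) → Set
IsInjective f = ∀ i j → f i ≡ f j → i ≡ j

-- The body of isPerm?, so filtering by isInjective? is filtering Sym n.
isInjective? : ∀ {n m} (f : Fin n → Fin m) → Dec (IsInjective f)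
isInjective? f = all? λ i → all? λ j → (f i Fin.≟ f j) →-dec (i Fin.≟ j)

Avoids : ∀ {n m} → Fin m → (Fin n → Fin m) → Set
Avoids j f = ∀ r → f r ≢ j

avoids? : ∀ {n m} (j : Fin m) (f : Fin n → Fin m) → Dec (Avoids j f)
avoids? j f = all? λ r → ¬? (f r Fin.≟ j)

isInjective-≗ : ∀ {n m} {f g : Fin n → Fin m} → f ≗ g → IsInjective f → IsInjective g
isInjective-≗ f≗g f-inj i j gi≡gj = f-inj i j (trans (f≗g i) (trans gi≡gj (sym (f≗g j))))

isInjective-∷ : ∀ {n m} (j : Fin m) (f : Fin n → Fin m) →
  IsInjective (j Vector.∷ f) ⇔ (Avoids j f × IsInjective f)
isInjective-∷ j f = mk⇔ to from
  where
  to : IsInjective (j Vector.∷ f) → Avoids j f × IsInjective f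
  to inj = (λ r fr≡j → 0≢1+n (inj zero (suc r) (sym fr≡j)))
         , (λ r s fr≡fs → suc-injective (inj (suc r) (suc s) fr≡fs))
  from : Avoids j f × IsInjective f → IsInjective (j Vector.∷ f)
  from (avoids , inj) zero    zero    _ = refl
  from (avoids , inj) zero    (suc s) p = ⊥-elim (avoids s (sym p))
  from (avoids , inj) (suc r) zero    p = ⊥-elim (avoids r p)
  from (avoids , inj) (suc r) (suc s) p = cong suc (inj r s p)

isInjective-punchIn-∘ : ∀ {n m} (j : Fin (suc m)) (h : Fin n → Fin m) →
  IsInjective (punchIn j ∘ h) ⇔ IsInjective h
isInjective-punchIn-∘ j h = mk⇔
  (λ inj r s hr≡hs → inj r s (cong (punchIn j) hr≡hs))
  (λ inj r s p → inj r s (punchIn-injective j _ _ p))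

sumFuns : (n m : ℕ) → ((Fin n → Fin m) → ℤ[ι]) → ℤ[ι]
sumFuns n m F = sumList (map F (allFuns n m))

-- allFuns builds its functions with pattern lambdas, which are only pointwise equal to the
-- corresponding Vector._∷_; lacking function extensionality, sums over allFuns are rewritten
-- through summands that respect _≗_.
Extensional : ∀ {n m} → ((Fin n → Fin m) → ℤ[ι]) → Set
Extensional F = ∀ {f g} → f ≗ g → F f ≡ F g

sumFuns-cong : ∀ {n m} {F G : (Fin n → Fin m) → ℤ[ι]} → (∀ f → F f ≡ G f) →
  sumFuns n m F ≡ sumFuns n m G
sumFuns-cong {n} {m} F≗G = cong sumList (List.map-cong F≗G (allFuns n m))

sumFuns-suc : ∀ n m (F : (Fin (suc n) → Fin m) → ℤ[ι]) → Extensional F →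
  sumFuns (suc n) m F ≡ ∑[ j < m ] sumFuns n m (λ f → F (j Vector.∷ f))
sumFuns-suc n m F F-ext =
  trans (sumList-concatMap-map _ (List.allFin m) (allFuns n m)
                               (λ j f → F-ext λ { zero → refl ; (suc x) → refl }))
        (sumList-allFin m _)
  where
  sumList-concatMap-map : ∀ {A B C : Set} {F : C → ℤ[ι]} {G : A → B → ℤ[ι]} (c : A → B → C) xs ys →
    (∀ x y → F (c x y) ≡ G x y) →
    sumList (map F (concatMap (λ x → map (c x) ys) xs)) ≡ sumList (map (λ x → sumList (map (G x) ys)) xs)
  sumList-concatMap-map {F = F} c xs ys F∘c≗G = trans (sumList-concatMap F _ xs)
    (cong sumList (List.map-cong (λ x → trans (cong sumList (sym (List.map-∘ ys)))
                                              (cong sumList (List.map-cong (F∘c≗G x) ys))) xs))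

does-avoids?-≗ : ∀ {n m} (j : Fin m) {f g : Fin n → Fin m} → f ≗ g →
  does (avoids? j f) ≡ does (avoids? j g)
does-avoids?-≗ j f≗g = does-⇔ (mk⇔ (λ a r → subst (_≢ j) (f≗g r) (a r))
                                   (λ a r → subst (_≢ j) (sym (f≗g r)) (a r))) (avoids? j _) (avoids? j _)

does-isInjective?-≗ : ∀ {n m} {f g : Fin n → Fin m} → f ≗ g →
  does (isInjective? f) ≡ does (isInjective? g)
does-isInjective?-≗ f≗g =
  does-⇔ (mk⇔ (isInjective-≗ f≗g) (isInjective-≗ (sym ∘ f≗g))) (isInjective? _) (isInjective? _)

sumFuns-[∧]· : ∀ {n m} a (b : (Fin n → Fin m) → Bool) (F : (Fin n → Fin m) → ℤ[ι]) →
  sumFuns n m (λ f → [ a ∧ b f ]· F f) ≡ [ a ]· sumFuns n m (λ f → [ b f ]· F f)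
sumFuns-[∧]· {n} {m} true  b F = refl
sumFuns-[∧]· {n} {m} false b F = sumList-[]· false (λ f → [ b f ]· F f) (allFuns n m)

sum-punchIn : ∀ m (j : Fin (suc m)) (K : Fin (suc m) → ℤ[ι]) →
  ∑[ c < suc m ] ([ not (does (c Fin.≟ j)) ]· K c) ≡ ∑[ c < m ] K (punchIn j c)
sum-punchIn m j K = begin
  ∑[ c < suc m ] ([ not (does (c Fin.≟ j)) ]· K c)
    ≡⟨ sum-remove {i = j} (λ c → [ not (does (c Fin.≟ j)) ]· K c) ⟩
  [ not (does (j Fin.≟ j)) ]· K j ⊕ ∑[ c < m ] ([ not (does (punchIn j c Fin.≟ j)) ]· K (punchIn j c))
    ≡⟨ cong₂ _⊕_ (cong (λ b → [ not b ]· K j) (dec-true (j Fin.≟ j) refl))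
                 (sum-cong-≗ λ c → cong (λ b → [ not b ]· K (punchIn j c))
                                        (dec-false (punchIn j c Fin.≟ j) (punchInᵢ≢i j c))) ⟩
  𝟘 ⊕ ∑[ c < m ] K (punchIn j c)
    ≡⟨ ⊕-identityˡ _ ⟩
  ∑[ c < m ] K (punchIn j c) ∎
  where open ≡-Reasoning

sumFuns-avoiding : ∀ n m (j : Fin (suc m)) (F : (Fin n → Fin (suc m)) → ℤ[ι]) → Extensional F →
  sumFuns n (suc m) (λ g → [ does (avoids? j g) ]· F g) ≡ sumFuns n m (λ h → F (punchIn j ∘ h))
sumFuns-avoiding zero    m j F F-ext = cong (_⊕ 𝟘) (F-ext λ ())
sumFuns-avoiding (suc n) m j F F-ext = begin
  sumFuns (suc n) (suc m) (λ g → [ does (avoids? j g) ]· F g)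
    ≡⟨ sumFuns-suc n (suc m) _ (λ f≗g → cong₂ [_]·_ (does-avoids?-≗ j f≗g) (F-ext f≗g)) ⟩
  ∑[ c < suc m ] sumFuns n (suc m) (λ f → [ not (does (c Fin.≟ j)) ∧ does (avoids? j f) ]· F (c Vector.∷ f))
    ≡⟨ sum-cong-≗ (λ c → sumFuns-[∧]· {n} (not (does (c Fin.≟ j))) (does ∘ avoids? j) (F ∘ (c Vector.∷_))) ⟩
  ∑[ c < suc m ] ([ not (does (c Fin.≟ j)) ]· sumFuns n (suc m) (λ f → [ does (avoids? j f) ]· F (c Vector.∷ f)))
    ≡⟨ sum-cong-≗ (λ c → cong ([ not (does (c Fin.≟ j)) ]·_)
                              (sumFuns-avoiding n m j _ λ f≗g → F-ext (∷-congʳ c f≗g))) ⟩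
  ∑[ c < suc m ] ([ not (does (c Fin.≟ j)) ]· sumFuns n m (λ h → F (c Vector.∷ (punchIn j ∘ h))))
    ≡⟨ sum-punchIn m j (λ c → sumFuns n m (λ h → F (c Vector.∷ (punchIn j ∘ h)))) ⟩
  ∑[ c < m ] sumFuns n m (λ h → F (punchIn j c Vector.∷ (punchIn j ∘ h)))
    ≡⟨ sum-cong-≗ (λ c → sumFuns-cong λ h → F-ext (punchIn-∷ c h)) ⟩
  ∑[ c < m ] sumFuns n m (λ h → F (punchIn j ∘ (c Vector.∷ h)))
    ≡⟨ sumFuns-suc n m _ (λ f≗g → F-ext (cong (punchIn j) ∘ f≗g)) ⟨
  sumFuns (suc n) m (λ h → F (punchIn j ∘ h)) ∎
  where
  open ≡-Reasoning
  ∷-congʳ : ∀ {A : Set} {n} (c : A) {f g : Fin n → A} → f ≗ g → (c Vector.∷ f) ≗ (c Vector.∷ g)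
  ∷-congʳ c f≗g zero    = refl
  ∷-congʳ c f≗g (suc x) = f≗g x
  punchIn-∷ : ∀ c (h : Fin n → Fin m) → (punchIn j c Vector.∷ (punchIn j ∘ h)) ≗ punchIn j ∘ (c Vector.∷ h)
  punchIn-∷ c h zero    = refl
  punchIn-∷ c h (suc x) = refl

prodFin-cong : ∀ n {u v : Fin n → ℤ[ι]} → u ≗ v → prodFin n u ≡ prodFin n v
prodFin-cong zero    u≗v = refl
prodFin-cong (suc n) u≗v = cong₂ _⊗_ (u≗v zero) (prodFin-cong n (u≗v ∘ suc))

weight : ∀ {n m} → (Fin n → Fin m → ℤ[ι]) → (Fin n → Fin m) → ℤ[ι]
weight {n} A f = [ does (isInjective? f) ]· prodFin n (λ r → A r (f r))

weight-ext : ∀ {n m} (A : Fin n → Fin m → ℤ[ι]) → Extensional (weight A)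
weight-ext {n} A f≗g = cong₂ [_]·_ (does-isInjective?-≗ f≗g) (prodFin-cong n (λ r → cong (A r) (f≗g r)))

weight-∷ : ∀ {n m} (A : Fin (suc n) → Fin m → ℤ[ι]) j f →
  weight A (j Vector.∷ f) ≡ [ does (avoids? j f) ]· (A zero j ⊗ weight (A ∘ suc) f)
weight-∷ {n} A j f = begin
  [ does (isInjective? (j Vector.∷ f)) ]· (A zero j ⊗ prodFin n (λ r → A (suc r) (f r)))
    ≡⟨ cong ([_]· (A zero j ⊗ prodFin n (λ r → A (suc r) (f r))))
            (does-⇔ (isInjective-∷ j f) (isInjective? (j Vector.∷ f)) (avoids? j f ×-dec isInjective? f)) ⟩
  [ does (avoids? j f) ∧ does (isInjective? f) ]· (A zero j ⊗ prodFin n (λ r → A (suc r) (f r)))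
    ≡⟨ [∧]· (does (avoids? j f)) _ _ ⟩
  [ does (avoids? j f) ]· [ does (isInjective? f) ]· (A zero j ⊗ prodFin n (λ r → A (suc r) (f r)))
    ≡⟨ cong ([ does (avoids? j f) ]·_) ([]·-⊗ (does (isInjective? f)) (A zero j) _) ⟩
  [ does (avoids? j f) ]· (A zero j ⊗ weight (A ∘ suc) f) ∎
  where open ≡-Reasoning

weight-punchIn : ∀ {n m} (A : Fin n → Fin (suc m) → ℤ[ι]) j h →
  weight A (punchIn j ∘ h) ≡ weight (λ r c → A r (punchIn j c)) h
weight-punchIn {n} A j h = cong ([_]· prodFin n (λ r → A r (punchIn j (h r))))
  (does-⇔ (isInjective-punchIn-∘ j h) (isInjective? (punchIn j ∘ h)) (isInjective? h))

per-as-sumFuns : ∀ {n} (A : Matrix n) → per A ≡ sumFuns n n (weight A)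
per-as-sumFuns {n} A = sumList-filter isInjective? _ (allFuns n n)

minor : ∀ {n} → Matrix (suc n) → Fin (suc n) → Matrix n
minor A j r c = A (suc r) (punchIn j c)

per-expand : ∀ {n} (A : Matrix (suc n)) → per A ≡ ∑[ j < suc n ] (A zero j ⊗ per (minor A j))
per-expand {n} A = begin
  per A
    ≡⟨ per-as-sumFuns A ⟩
  sumFuns (suc n) (suc n) (weight A)
    ≡⟨ sumFuns-suc n (suc n) (weight A) (weight-ext A) ⟩
  ∑[ j < suc n ] sumFuns n (suc n) (λ f → weight A (j Vector.∷ f))
    ≡⟨ sum-cong-≗ (λ j → sumFuns-cong (weight-∷ A j)) ⟩
  ∑[ j < suc n ] sumFuns n (suc n) (λ f → [ does (avoids? j f) ]· (A zero j ⊗ weight (A ∘ suc) f))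
    ≡⟨ sum-cong-≗ (λ j → sumFuns-avoiding n n j _ (cong (A zero j ⊗_) ∘ weight-ext (A ∘ suc))) ⟩
  ∑[ j < suc n ] sumFuns n n (λ h → A zero j ⊗ weight (A ∘ suc) (punchIn j ∘ h))
    ≡⟨ sum-cong-≗ (λ j → sumFuns-cong (cong (A zero j ⊗_) ∘ weight-punchIn (A ∘ suc) j)) ⟩
  ∑[ j < suc n ] sumFuns n n (λ h → A zero j ⊗ weight (minor A j) h)
    ≡⟨ sum-cong-≗ (λ j → trans (sumList-⊗ (A zero j) _ (allFuns n n))
                                (cong (A zero j ⊗_) (sym (per-as-sumFuns (minor A j))))) ⟩
  ∑[ j < suc n ] (A zero j ⊗ per (minor A j)) ∎
  where open ≡-Reasoning

per-cong : ∀ {n} {A B : Matrix n} → (∀ r c → A r c ≡ B r c) → per A ≡ per B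
per-cong {n} {A} {B} A≡B = begin
  per A                      ≡⟨ per-as-sumFuns A ⟩
  sumFuns n n (weight A)     ≡⟨ sumFuns-cong (λ σ → cong (λ x → [ does (isInjective? σ) ]· x)
                                                        (prodFin-cong n (λ r → A≡B r (σ r)))) ⟩
  sumFuns n n (weight B)     ≡⟨ per-as-sumFuns B ⟨
  per B                      ∎
  where open ≡-Reasoning

per-1×1 : (A : Matrix 1) → per A ≡ A 0F 0F
per-1×1 A = trans (⊕-identityʳ _) (⊗-identityʳ _)

per-lowerHessenberg : ∀ {n} (A : Matrix (suc (suc n))) → (∀ j → A 0F (suc (suc j)) ≡ 𝟘) →
  per A ≡ A 0F 0F ⊗ per (minor A 0F) ⊕ A 0F 1F ⊗ per (minor A 1F)
per-lowerHessenberg {n} A zero-row = begin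
  per A                                      ≡⟨ per-expand A ⟩
  t 0F ⊕ (t 1F ⊕ ∑[ j < n ] t (suc (suc j))) ≡⟨ cong (λ x → t 0F ⊕ (t 1F ⊕ x)) rest≡𝟘 ⟩
  t 0F ⊕ (t 1F ⊕ 𝟘)                          ≡⟨ cong (t 0F ⊕_) (⊕-identityʳ (t 1F)) ⟩
  t 0F ⊕ t 1F                                ∎
  where
  open ≡-Reasoning
  t : Fin (suc (suc n)) → ℤ[ι]
  t j = A 0F j ⊗ per (minor A j)
  rest≡𝟘 : ∑[ j < n ] t (suc (suc j)) ≡ 𝟘
  rest≡𝟘 = trans (sum-cong-≗ λ j → trans (cong (_⊗ per (minor A (suc (suc j)))) (zero-row j))
                                         (⊗-zeroˡ (per (minor A (suc (suc j))))))
                 (sum-replicate-zero n)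

-- Lower Hessenberg Toeplitz matrices

hessenbergPer : (ℕ → ℤ[ι]) → ℤ[ι] → ℕ → ℕ → ℤ[ι]
hessenbergPer w σ d zero    = w d
hessenbergPer w σ d (suc m) = w d ⊗ hessenbergPer w σ 0 m ⊕ σ ⊗ hessenbergPer w σ (suc d) m

module ToeplitzHessenberg (E : ℕ → ℕ → ℤ[ι])
  (E-toeplitz : ∀ s t → E (suc s) (suc t) ≡ E s t)
  (E-hessenberg : ∀ t → E 0 (suc (suc t)) ≡ 𝟘) where

  columnShifted : ℕ → (n : ℕ) → Matrix n
  columnShifted d n r zero    = E (toℕ r ℕ.+ d) 0
  columnShifted d n r (suc c) = E (toℕ r) (suc (toℕ c))

  per-columnShifted : ∀ d m → per (columnShifted d (suc m)) ≡ hessenbergPer (λ s → E s 0) (E 0 1) d m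
  per-columnShifted d zero    = per-1×1 (columnShifted d 1)
  per-columnShifted d (suc m) = begin
    per A
      ≡⟨ per-lowerHessenberg A (λ j → E-hessenberg (toℕ j)) ⟩
    E d 0 ⊗ per (minor A 0F) ⊕ E 0 1 ⊗ per (minor A 1F)
      ≡⟨ cong₂ (λ x y → E d 0 ⊗ x ⊕ E 0 1 ⊗ y) (per-cong minor₀) (per-cong minor₁) ⟩
    E d 0 ⊗ per (columnShifted 0 (suc m)) ⊕ E 0 1 ⊗ per (columnShifted (suc d) (suc m))
      ≡⟨ cong₂ (λ x y → E d 0 ⊗ x ⊕ E 0 1 ⊗ y) (per-columnShifted 0 m) (per-columnShifted (suc d) m) ⟩
    hessenbergPer (λ s → E s 0) (E 0 1) d (suc m) ∎
    where
    open ≡-Reasoning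
    A : Matrix (suc (suc m))
    A = columnShifted d (suc (suc m))
    minor₀ : ∀ r c → minor A 0F r c ≡ columnShifted 0 (suc m) r c
    minor₀ r zero    = trans (E-toeplitz (toℕ r) 0) (cong (λ s → E s 0) (sym (ℕ.+-identityʳ (toℕ r))))
    minor₀ r (suc c) = E-toeplitz (toℕ r) (suc (toℕ c))
    minor₁ : ∀ r c → minor A 1F r c ≡ columnShifted (suc d) (suc m) r c
    minor₁ r zero    = cong (λ s → E s 0) (sym (ℕ.+-suc (toℕ r) d))
    minor₁ r (suc c) = E-toeplitz (toℕ r) (suc (toℕ c))

  per-toeplitzHessenberg : ∀ m →
    per {suc m} (λ r c → E (toℕ r) (toℕ c)) ≡ hessenbergPer (λ s → E s 0) (E 0 1) 0 m
  per-toeplitzHessenberg m = trans (per-cong entries) (per-columnShifted 0 m)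
    where
    entries : ∀ r c → E (toℕ r) (toℕ c) ≡ columnShifted 0 (suc m) r c
    entries r zero    = cong (λ s → E s 0) (sym (ℕ.+-identityʳ (toℕ r)))
    entries r (suc c) = refl

hessenbergPer-ιpow : ∀ (c : ℕ → ℕ) (F : ℕ → ℕ → ℕ) (w : ℕ → ℤ[ι]) →
  (∀ d → w d ≡ ιpow (+ d) ⊗ fromℕ (c d)) →
  (∀ d → F d 0 ≡ c d) → (∀ d m → F d (suc m) ≡ c d ℕ.* F 0 m ℕ.+ F (suc d) m) →
  ∀ d m → hessenbergPer w -ι d m ≡ ιpow (+ d) ⊗ fromℕ (F d m)
hessenbergPer-ιpow c F w w≡ F-zero F-suc d zero =
  trans (w≡ d) (cong (λ x → ιpow (+ d) ⊗ fromℕ x) (sym (F-zero d)))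
hessenbergPer-ιpow c F w w≡ F-zero F-suc d (suc m) = begin
  w d ⊗ hessenbergPer w -ι 0 m ⊕ -ι ⊗ hessenbergPer w -ι (suc d) m
    ≡⟨ cong₂ (λ x y → x ⊗ y ⊕ -ι ⊗ hessenbergPer w -ι (suc d) m) (w≡ d) (trans (IH 0) (⊗-identityˡ _)) ⟩
  (ιᵈ ⊗ fromℕ (c d)) ⊗ fromℕ (F 0 m) ⊕ -ι ⊗ hessenbergPer w -ι (suc d) m
    ≡⟨ cong₂ _⊕_ (⊗-assoc ιᵈ _ _) (cong (-ι ⊗_) (IH (suc d))) ⟩
  ιᵈ ⊗ (fromℕ (c d) ⊗ fromℕ (F 0 m)) ⊕ -ι ⊗ (ιpow (+ suc d) ⊗ fromℕ (F (suc d) m))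
    ≡⟨ cong (ιᵈ ⊗ (fromℕ (c d) ⊗ fromℕ (F 0 m)) ⊕_)
            (trans (sym (⊗-assoc -ι (ιpow (+ suc d)) (fromℕ (F (suc d) m))))
                   (cong (_⊗ fromℕ (F (suc d) m)) (-ι⊗ιpow-suc d))) ⟩
  ιᵈ ⊗ (fromℕ (c d) ⊗ fromℕ (F 0 m)) ⊕ ιᵈ ⊗ fromℕ (F (suc d) m)
    ≡⟨ ⊗-distribˡ-⊕ ιᵈ _ _ ⟨
  ιᵈ ⊗ (fromℕ (c d) ⊗ fromℕ (F 0 m) ⊕ fromℕ (F (suc d) m))
    ≡⟨ cong (λ x → ιᵈ ⊗ (x ⊕ fromℕ (F (suc d) m))) (fromℕ-* (c d) (F 0 m)) ⟨
  ιᵈ ⊗ fromℕ (c d ℕ.* F 0 m ℕ.+ F (suc d) m)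
    ≡⟨ cong (λ x → ιᵈ ⊗ fromℕ x) (F-suc d m) ⟨
  ιᵈ ⊗ fromℕ (F d (suc m)) ∎
  where
  open ≡-Reasoning
  ιᵈ = ιpow (+ d)
  IH : ∀ e → hessenbergPer w -ι e m ≡ ιpow (+ e) ⊗ fromℕ (F e m)
  IH e = hessenbergPer-ιpow c F w w≡ F-zero F-suc e m

-- Generalized order-k numbers

ordK-recurrence : (k λ' i M : ℕ) → ℕ
ordK-recurrence k λ' i M = λ' ℕ.* ordK k λ' i M ℕ.+ sumℕ (take (k ∸ 1) (drop 1 (history k λ' i M)))

ordK-suc : ∀ k λ' i M →
  ordK k λ' i (suc M) ≡ (if does (suc M ℕ.<? k) then initVal k i (suc M) else ordK-recurrence k λ' i M)
ordK-suc k λ' i zero    = refl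
ordK-suc k λ' i (suc M) = refl

ordK-initial : ∀ k λ' i M → suc M < k → ordK k λ' i (suc M) ≡ initVal k i (suc M)
ordK-initial k λ' i M 1+M<k = trans (ordK-suc k λ' i M)
  (cong (if_then initVal k i (suc M) else ordK-recurrence k λ' i M) (dec-true (suc M ℕ.<? k) 1+M<k))

ordK-step : ∀ k λ' i M → k ≤ suc M → ordK k λ' i (suc M) ≡ ordK-recurrence k λ' i M
ordK-step k λ' i M k≤1+M = trans (ordK-suc k λ' i M)
  (cong (if_then initVal k i (suc M) else ordK-recurrence k λ' i M) (dec-false (suc M ℕ.<? k) (ℕ.≤⇒≯ k≤1+M)))

sum-take-replicate-0-++ : ∀ j r xs → j ≤ r → sumℕ (take j (List.replicate r 0 ++ xs)) ≡ 0
sum-take-replicate-0-++ zero    r       xs _         = refl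
sum-take-replicate-0-++ (suc j) (suc r) xs (s≤s j≤r) = sum-take-replicate-0-++ j r xs j≤r

sum-take-replicate-0-∷ʳ : ∀ r x → sumℕ (take (suc r) (List.replicate r 0 ∷ʳ x)) ≡ x
sum-take-replicate-0-∷ʳ zero    x = ℕ.+-identityʳ x
sum-take-replicate-0-∷ʳ (suc r) x = sum-take-replicate-0-∷ʳ r x

-- The body of H, so that H k λ' n is definitionally λ s t → hEntry k λ' (toℕ s) (toℕ t).
hEntry : (k λ' : ℕ) → ℕ → ℕ → ℤ[ι]
hEntry k λ' s t =
  if does (s ℕ.≟ t) then fromℕ λ'
  else if does ((-[1+ 0 ] ℤ.≤? d) ×-dec (d ℤ.<? + k)) then ιpow d
  else 𝟘
  where d = s ⊖ t

hEntry-toeplitz : ∀ k λ' s t → hEntry k λ' (suc s) (suc t) ≡ hEntry k λ' s t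
hEntry-toeplitz k λ' s t rewrite ℤ.[1+m]⊖[1+n]≡m⊖n s t = refl

k∸1+d≡1+k∸2+d : ∀ {k d} → suc d < k → k ∸ suc d ≡ suc (k ∸ suc (suc d))
k∸1+d≡1+k∸2+d {k} 1+d<k = ℕ.+-∸-assoc 1 {k} 1+d<k

module KthSequence (k₀ λ' : ℕ) where

  k : ℕ
  k = suc (suc k₀)

  history-initial : ∀ j → j < k → history k λ' k j ≡ List.replicate j 0 ∷ʳ 1
  history-initial zero    _   = cong (λ b → (if b then 1 else 0) ∷ []) (dec-true (k ℕ.+ 0 ℕ.≟ k) (ℕ.+-identityʳ k))
  history-initial (suc j) j<k = cong₂ _∷_
    (trans (ordK-initial k λ' k j j<k) (cong (if_then 1 else 0) (dec-false (k ℕ.+ suc j ℕ.≟ k) (ℕ.m+1+n≢m k))))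
    (history-initial j (ℕ.<-trans (ℕ.n<1+n j) j<k))

  ordK-k : ordK k λ' k k ≡ 1
  ordK-k = begin
    ordK k λ' k k
      ≡⟨ ordK-step k λ' k (suc k₀) ℕ.≤-refl ⟩
    λ' ℕ.* ordK k λ' k (suc k₀) ℕ.+ sumℕ (take (suc k₀) (history k λ' k k₀))
      ≡⟨ cong₂ (λ x xs → λ' ℕ.* x ℕ.+ sumℕ (take (suc k₀) xs))
               (List.∷-injectiveˡ (history-initial (suc k₀) ℕ.≤-refl))
               (history-initial k₀ (ℕ.≤-trans (ℕ.n<1+n k₀) (ℕ.n≤1+n (suc k₀)))) ⟩
    λ' ℕ.* 0 ℕ.+ sumℕ (take (suc k₀) (List.replicate k₀ 0 ∷ʳ 1))
      ≡⟨ cong₂ ℕ._+_ (ℕ.*-zeroʳ λ') (sum-take-replicate-0-∷ʳ k₀ 1) ⟩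
    1 ∎
    where open ≡-Reasoning

  history-k : history k λ' k k ≡ 1 ∷ List.replicate (suc k₀) 0 ∷ʳ 1
  history-k = cong₂ _∷_ ordK-k (history-initial (suc k₀) ℕ.≤-refl)

  coeff : ℕ → ℕ
  coeff zero    = λ'
  coeff (suc d) = if does (suc d ℕ.<? k) then 1 else 0

  coeff-< : ∀ {d} → suc d < k → coeff (suc d) ≡ 1
  coeff-< {d} 1+d<k = cong (if_then 1 else 0) (dec-true (suc d ℕ.<? k) 1+d<k)

  coeff-≮ : ∀ {d} → ¬ suc d < k → coeff (suc d) ≡ 0
  coeff-≮ {d} 1+d≮k = cong (if_then 1 else 0) (dec-false (suc d ℕ.<? k) 1+d≮k)

  -- Writing a_n = ordK k λ' k (n + k ∸ 1): tailSum 0 m = a_{m+2} and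
  -- tailSum (1 + d) m = a_{m+1} + ⋯ + a_{m+d+3-k}.
  tailSum : ℕ → ℕ → ℕ
  tailSum zero    m = ordK k λ' k (suc (m ℕ.+ k))
  tailSum (suc d) m = sumℕ (take (k ∸ suc d) (history k λ' k (m ℕ.+ k)))

  tailSum-zero : ∀ d → tailSum d 0 ≡ coeff d
  tailSum-zero zero = begin
    ordK k λ' k (suc k)
      ≡⟨ ordK-step k λ' k k (ℕ.n≤1+n k) ⟩
    λ' ℕ.* ordK k λ' k k ℕ.+ sumℕ (take (suc k₀) (drop 1 (history k λ' k k)))
      ≡⟨ cong₂ (λ x xs → λ' ℕ.* x ℕ.+ sumℕ (take (suc k₀) (drop 1 xs))) ordK-k history-k ⟩
    λ' ℕ.* 1 ℕ.+ sumℕ (take (suc k₀) (List.replicate (suc k₀) 0 ∷ʳ 1))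
      ≡⟨ cong₂ ℕ._+_ (ℕ.*-identityʳ λ') (sum-take-replicate-0-++ (suc k₀) (suc k₀) _ ℕ.≤-refl) ⟩
    λ' ℕ.+ 0
      ≡⟨ ℕ.+-identityʳ λ' ⟩
    λ' ∎
    where open ≡-Reasoning
  tailSum-zero (suc d) with suc d ℕ.<? k
  ... | yes 1+d<k = begin
    sumℕ (take (k ∸ suc d) (history k λ' k k))
      ≡⟨ cong₂ (λ j xs → sumℕ (take j xs)) (k∸1+d≡1+k∸2+d 1+d<k) history-k ⟩
    1 ℕ.+ sumℕ (take (k ∸ suc (suc d)) (List.replicate (suc k₀) 0 ∷ʳ 1))
      ≡⟨ cong (1 ℕ.+_) (sum-take-replicate-0-++ (k ∸ suc (suc d)) (suc k₀) _
                                                (ℕ.≤-trans (ℕ.m∸n≤m k₀ d) (ℕ.n≤1+n k₀))) ⟩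
    1
      ≡⟨ coeff-< 1+d<k ⟨
    coeff (suc d) ∎
    where open ≡-Reasoning
  ... | no 1+d≮k = trans (cong (λ j → sumℕ (take j (history k λ' k k))) (ℕ.m≤n⇒m∸n≡0 (ℕ.≮⇒≥ 1+d≮k)))
                         (sym (coeff-≮ 1+d≮k))

  tailSum-suc : ∀ d m → tailSum d (suc m) ≡ coeff d ℕ.* tailSum 0 m ℕ.+ tailSum (suc d) m
  tailSum-suc zero m = ordK-step k λ' k (suc (m ℕ.+ k)) (ℕ.m≤n+m k (suc (suc m)))
  tailSum-suc (suc d) m with suc d ℕ.<? k
  ... | yes 1+d<k = begin
    sumℕ (take (k ∸ suc d) (tailSum 0 m ∷ history k λ' k (m ℕ.+ k)))
      ≡⟨ cong (λ j → sumℕ (take j (tailSum 0 m ∷ history k λ' k (m ℕ.+ k)))) (k∸1+d≡1+k∸2+d 1+d<k) ⟩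
    tailSum 0 m ℕ.+ tailSum (suc (suc d)) m
      ≡⟨ cong (ℕ._+ tailSum (suc (suc d)) m) (ℕ.*-identityˡ (tailSum 0 m)) ⟨
    1 ℕ.* tailSum 0 m ℕ.+ tailSum (suc (suc d)) m
      ≡⟨ cong (λ c → c ℕ.* tailSum 0 m ℕ.+ tailSum (suc (suc d)) m) (coeff-< 1+d<k) ⟨
    coeff (suc d) ℕ.* tailSum 0 m ℕ.+ tailSum (suc (suc d)) m ∎
    where open ≡-Reasoning
  ... | no 1+d≮k = begin
    sumℕ (take (k ∸ suc d) (history k λ' k (suc (m ℕ.+ k))))
      ≡⟨ cong (λ j → sumℕ (take j (history k λ' k (suc (m ℕ.+ k))))) (ℕ.m≤n⇒m∸n≡0 k≤1+d) ⟩
    0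
      ≡⟨ cong₂ (λ c j → c ℕ.* tailSum 0 m ℕ.+ sumℕ (take j (history k λ' k (m ℕ.+ k))))
               (coeff-≮ 1+d≮k) (ℕ.m≤n⇒m∸n≡0 (ℕ.≤-trans k≤1+d (ℕ.n≤1+n (suc d)))) ⟨
    coeff (suc d) ℕ.* tailSum 0 m ℕ.+ tailSum (suc (suc d)) m ∎
    where
    open ≡-Reasoning
    k≤1+d = ℕ.≮⇒≥ 1+d≮k

  hEntry-column : ∀ d → hEntry k λ' d 0 ≡ ιpow (+ d) ⊗ fromℕ (coeff d)
  hEntry-column zero    = sym (⊗-identityˡ (fromℕ λ'))
  hEntry-column (suc d) = entry (does (suc d ℕ.<? k))
    where
    entry : ∀ b → (if b then ιpow (+ suc d) else 𝟘) ≡ ιpow (+ suc d) ⊗ fromℕ (if b then 1 else 0)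
    entry true  = sym (⊗-identityʳ (ιpow (+ suc d)))
    entry false = sym (⊗-zeroʳ (ιpow (+ suc d)))

theorem1p16 : (k λ' n : ℕ) → 2 ≤ k → 1 ≤ λ' → 1 ≤ n →
    per (H k λ' n) ≡ fromℕ (a k λ' k (suc n))
theorem1p16 (suc (suc k₀)) λ' (suc m) _ _ _ = begin
  per (H k λ' (suc m))
    ≡⟨ per-toeplitzHessenberg m ⟩
  hessenbergPer (λ s → hEntry k λ' s 0) -ι 0 m
    ≡⟨ hessenbergPer-ιpow coeff tailSum _ hEntry-column tailSum-zero tailSum-suc 0 m ⟩
  𝟙 ⊗ fromℕ (tailSum 0 m)
    ≡⟨ ⊗-identityˡ _ ⟩
  fromℕ (a k λ' k (suc (suc m))) ∎
  where
  open ≡-Reasoning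
  open KthSequence k₀ λ'
  open ToeplitzHessenberg (hEntry k λ') (hEntry-toeplitz k λ') (λ _ → refl)
theorem1p16 (suc zero) λ' n (s≤s ()) _ _
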